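{- Let $k\ge 3$ and $n\ge k+2$ be integers. Let $\mathcal{F}\subseteq\binom{[n]}{k}$ be an intersecting family, and let $\mathcal{F}'\subseteq\mathcal{F}$ be a subfamily with disjoint sets $S,A\subseteq V(\mathcal{F}')$ such that $|S|=k-2$. Then: (1) $N_{\mathcal{F}'}(S)$ and $P_{\mathcal{F}'}(A)$ are cross-intersecting, i.e. every member of $N_{\mathcal{F}'}(S)$ intersects every member of $P_{\mathcal{F}'}(A)$. (2) If $|N_{\mathcal{F}}(S)|\ge n-k+1$ and $n\ge k+5$, then either $N_{\mathcal{F}}(S)$ is a complete star on $[n]\setminus S$ (i.e. there is $w\in[n]\setminus S$ such that $N_{\mathcal{F}}(S)$ consists of all pairs $\{w,z\}$ with $z\in[n]\setminus(S\cup\{w\})$), or there exists a family $\mathcal{F}''$ with $\mathcal{F}'\subseteq\mathcal{F}''\subseteq\mathcal{F}$ such that $|V(\mathcal{F}'')|\le|V(\mathcal{F}')|+6$ and $P_{\mathcal{F}''}(A)$, viewed as a graph, is a subgraph of a cherry.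
   Context: $\binom{[n]}{k}$ is the family of all $k$-subsets of $[n]=\{1,\dots,n\}$; a family is intersecting if any two members intersect. For a family $\mathcal{G}$, $V(\mathcal{G})=\bigcup_{f\in\mathcal{G}}f$. For a family $\mathcal{G}$ of $k$-sets and a set $S$ with $|S|<k$, $N_{\mathcal{G}}(S)$ is the family of $(k-|S|)$-sets $T$ with $T\cup S\in\mathcal{G}$ (here, with $|S|=k-2$, a graph on $[n]\setminus S$). A vertex cover of $\mathcal{G}$ is a set meeting every member of $\mathcal{G}$; for $A\subseteq V(\mathcal{G})$, $P_{\mathcal{G}}(A)$ is the family of all $2$-element vertex covers of $\mathcal{G}$ contained in $A$, viewed as a graph on vertex set $A$. A cherry is the graph $K_{1,2}$ (two edges sharing a vertex). -}

module Defs where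

open import Data.Nat using (ℕ; zero; suc)
open import Data.Bool using (Bool; true; false)
import Data.Bool.Properties as BoolP
open import Data.Fin using (Fin)
open import Data.Fin.Subset using (Subset; ⁅_⁆; _∈_; _∉_; _⊆_; _∩_; _∪_; ∣_∣; Nonempty; ⊥; inside; outside)
open import Data.Fin.Subset.Properties using (_⊆?_; nonempty?)
open import Data.Vec using (Vec; []; _∷_)
open import Data.Vec.Properties using (≡-dec)
open import Data.List using (List; []; _∷_; [_]; map; _++_; filter; foldr)
open import Data.List.Relation.Unary.All using (All; all?)
open import Data.Product using (Σ; ∃; ∃-syntax; _×_; _,_)
open import Data.Sum using (_⊎_)
open import Relation.Nullary using (¬_; Dec)
open import Relation.Nullary.Decidable using (_×-dec_)
open import Relation.Binary.PropositionalEquality using (_≡_; _≢_)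
open import Relation.Binary.Definitions using (DecidableEquality)
import Data.Nat.Properties as NatP
import Data.List.Membership.Propositional as MemP
import Data.List.Membership.DecPropositional as DecMem

_≟ₛ_ : {n : ℕ} → DecidableEquality (Subset n)
_≟ₛ_ = ≡-dec BoolP._≟_

Fam : ℕ → Set
Fam n = List (Subset n)

_∈ᶠ_ : {n : ℕ} → Subset n → Fam n → Set
_∈ᶠ_ = MemP._∈_

_∈ᶠ?_ : {n : ℕ} (f : Subset n) (F : Fam n) → Dec (f ∈ᶠ F)
_∈ᶠ?_ {n} = DecMem._∈?_ (_≟ₛ_ {n})

_⊆ᶠ_ : {n : ℕ} → Fam n → Fam n → Set
G ⊆ᶠ H = ∀ f → f ∈ᶠ G → f ∈ᶠ H

allSubsets : (n : ℕ) → List (Subset n)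
allSubsets zero = [ [] ]
allSubsets (suc n) = map (outside ∷_) (allSubsets n) ++ map (inside ∷_) (allSubsets n)

Uniform : {n : ℕ} → ℕ → Fam n → Set
Uniform k G = ∀ f → f ∈ᶠ G → ∣ f ∣ ≡ k

Intersecting : {n : ℕ} → Fam n → Set
Intersecting G = ∀ f g → f ∈ᶠ G → g ∈ᶠ G → Nonempty (f ∩ g)

Disjoint : {n : ℕ} → Subset n → Subset n → Set
Disjoint X Y = X ∩ Y ≡ ⊥

V : {n : ℕ} → Fam n → Subset n
V = foldr _∪_ ⊥

-- Neighbourhood N_G(S): the family of 2-sets T ⊆ [n] ∖ S with T ∪ S ∈ G
-- (|S| = k - 2 in our use, so this is the family of (k - |S|)-sets).
NCond : {n : ℕ} → Fam n → Subset n → Subset n → Set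
NCond G S T = (∣ T ∣ ≡ 2) × (Disjoint T S × ((T ∪ S) ∈ᶠ G))

NCond? : {n : ℕ} (G : Fam n) (S T : Subset n) → Dec (NCond G S T)
NCond? G S T = (∣ T ∣ NatP.≟ 2) ×-dec (((T ∩ S) ≟ₛ ⊥) ×-dec ((T ∪ S) ∈ᶠ? G))

N : {n : ℕ} → Fam n → Subset n → Fam n
N {n} G S = filter (NCond? G S) (allSubsets n)

VertexCover : {n : ℕ} → Fam n → Subset n → Set
VertexCover G e = All (λ f → Nonempty (e ∩ f)) G

PCond : {n : ℕ} → Fam n → Subset n → Subset n → Set
PCond G A e = (∣ e ∣ ≡ 2) × ((e ⊆ A) × VertexCover G e)

PCond? : {n : ℕ} (G : Fam n) (A e : Subset n) → Dec (PCond G A e)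
PCond? G A e = (∣ e ∣ NatP.≟ 2) ×-dec ((e ⊆? A) ×-dec all? (λ f → nonempty? (e ∩ f)) G)

P : {n : ℕ} → Fam n → Subset n → Fam n
P {n} G A = filter (PCond? G A) (allSubsets n)

CrossIntersecting : {n : ℕ} → Fam n → Fam n → Set
CrossIntersecting G H = ∀ g h → g ∈ᶠ G → h ∈ᶠ H → Nonempty (g ∩ h)

pair : {n : ℕ} → Fin n → Fin n → Subset n
pair x y = ⁅ x ⁆ ∪ ⁅ y ⁆

CompleteStar : {n : ℕ} → Fam n → Subset n → Set
CompleteStar {n} G S =
  Σ (Fin n) λ w → (w ∉ S) ×
    (∀ T → (T ∈ᶠ G → ∃[ z ] ((z ∉ S) × (z ≢ w) × (T ≡ pair w z)))
         × (∃[ z ] ((z ∉ S) × (z ≢ w) × (T ≡ pair w z)) → T ∈ᶠ G))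

SubCherry : {n : ℕ} → Fam n → Set
SubCherry {n} G =
  Σ (Fin n) λ a → Σ (Fin n) λ b → Σ (Fin n) λ c →
    (a ≢ b) × (a ≢ c) × (b ≢ c) ×
    (∀ e → e ∈ᶠ G → (e ≡ pair a b) ⊎ (e ≡ pair a c))

-- Part (1): a 2-cover e ⊆ A of F′ meets T ∪ S for every T ∈ N_F′(S), and e misses S since
-- A ∩ S = ∅, so e meets T.
--
-- Part (2) is a statement about the graph G = N_F(S) on the n − k + 2 vertices outside S,
-- which has at least n − k + 1 ≥ 6 edges. If all edges of G share a vertex w, then all
-- n − k + 1 possible edges at w are present, so G is the complete star. Otherwise G contains
-- a subgraph H on at most six vertices whose 2-vertex covers all lie in a cherry: a path on
-- three vertices plus a disjoint edge, a triangle with a pendant edge, or three disjoint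
-- edges (which have no 2-cover at all). Let F″ = F′ ∪ {T ∪ S : T ∈ H}. Since S ⊆ V(F′),
-- F″ has at most six new vertices, and a 2-cover of F″ inside A avoids S, hence covers H.

module Submission where

open import Defs
open import Data.Nat using (ℕ; zero; suc; _+_; _*_; _∸_; _≤_; _≥_; _<_; z≤n; s≤s)
import Data.Nat.Properties as ℕ
open import Data.Fin using (Fin; zero; suc)
import Data.Fin.Properties as Fin
open import Data.Fin.Subset
  using (Subset; ⁅_⁆; _∈_; _∉_; _⊆_; _∩_; _∪_; ∣_∣; Nonempty; Empty; ⊥; ⊤; ∁; _-_; inside; outside)
open import Data.Fin.Subset.Properties
  using ( _∈?_; _⊆?_; nonempty?; x∈p∪q⁺; x∈p∪q⁻; x∈p∩q⁺; x∈p∩q⁻; x∈⁅x⁆; x∈⁅y⁆⇒x≡y; ∉⊥; ⊆⊤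
        ; ∪-comm; ∩-comm; ∪-idem; ∪-identityˡ; ∣⁅x⁆∣≡1; ∣⊥∣≡0; p⊆q⇒∣p∣≤∣q∣; ∣∁p∣≡n∸∣p∣
        ; x∈p⇒∣p-x∣<∣p∣; x∈p∧x≢y⇒x∈p-y; x∉p⇒x∈∁p)
open import Data.Vec using ([]; _∷_; here; there)
open import Data.Vec.Properties using (∷-injectiveʳ)
open import Data.List using (List; []; _∷_; map; _++_; filter; length)
import Data.List.Properties as List
open import Data.List.Membership.Propositional using (find) renaming (_∈_ to _∈ₗ_)
open import Data.List.Membership.Propositional.Properties
  using (∈-map⁺; ∈-map⁻; ∈-++⁺ˡ; ∈-++⁺ʳ; ∈-++⁻; ∈-filter⁺; ∈-filter⁻)
import Data.List.Membership.DecPropositional as DecMembership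
open import Data.List.Relation.Unary.All using (All; []; _∷_; lookup; all?; tabulate)
open import Data.List.Relation.Unary.All.Properties using (¬All⇒Any¬)
open import Data.List.Relation.Unary.Any using (here; there)
import Data.List.Relation.Unary.Any as Any
open import Data.List.Relation.Unary.AllPairs using ([]; _∷_)
open import Data.List.Relation.Unary.Unique.Propositional using (Unique)
import Data.List.Relation.Unary.Unique.Propositional.Properties as Unique
open import Data.Product using (Σ; ∃₂; ∃-syntax; _×_; _,_; proj₁; proj₂)
open import Data.Sum using (_⊎_; inj₁; inj₂; [_,_]′)
import Data.Sum as Sum
open import Data.Empty using (⊥-elim)
open import Function using (_∘_; id)
open import Relation.Nullary using (¬_; yes; no; contradiction)
open import Relation.Nullary.Decidable using (¬?; _→-dec_)
open import Relation.Unary using (Decidable)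
open import Relation.Binary.Definitions using (DecidableEquality)
open import Relation.Binary.PropositionalEquality using (_≡_; _≢_; refl; sym; trans; cong; subst)

private
  variable
    n k : ℕ
    a a′ b c d d′ u v w x y z : Fin n
    p q e f S A D E T T₁ T₂ T₃ : Subset n
    F F′ G H : Fam n

∈pair⁻ : z ∈ pair x y → z ≡ x ⊎ z ≡ y
∈pair⁻ {x = x} {y} z∈ = Sum.map (x∈⁅y⁆⇒x≡y x) (x∈⁅y⁆⇒x≡y y) (x∈p∪q⁻ ⁅ x ⁆ ⁅ y ⁆ z∈)

x∈pair : (x y : Fin n) → x ∈ pair x y
x∈pair x y = x∈p∪q⁺ (inj₁ (x∈⁅x⁆ x))

y∈pair : (x y : Fin n) → y ∈ pair x y
y∈pair x y = x∈p∪q⁺ (inj₂ (x∈⁅x⁆ y))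

∉pair⁺ : z ≢ x → z ≢ y → z ∉ pair x y
∉pair⁺ z≢x z≢y z∈ = [ z≢x , z≢y ]′ (∈pair⁻ z∈)

∉pair⁻ : z ∉ pair x y → z ≢ x × z ≢ y
∉pair⁻ {x = x} {y} z∉xy = (λ { refl → z∉xy (x∈pair x y) }) , (λ { refl → z∉xy (y∈pair x y) })

pair-comm : (x y : Fin n) → pair x y ≡ pair y x
pair-comm x y = ∪-comm ⁅ x ⁆ ⁅ y ⁆

∈-pair-comm : pair x y ∈ᶠ G → pair y x ∈ᶠ G
∈-pair-comm {x = x} {y} = subst (_∈ᶠ _) (pair-comm x y)

pair⊆ : x ∈ p → y ∈ p → pair x y ⊆ p
pair⊆ x∈p y∈p z∈ with ∈pair⁻ z∈
... | inj₁ refl = x∈p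
... | inj₂ refl = y∈p

pair∩-nonempty⁻ : Nonempty (pair x y ∩ T) → x ∈ T ⊎ y ∈ T
pair∩-nonempty⁻ (z , z∈) with x∈p∩q⁻ _ _ z∈
... | z∈xy , z∈T with ∈pair⁻ z∈xy
... | inj₁ refl = inj₁ z∈T
... | inj₂ refl = inj₂ z∈T

∩pair-nonempty⁻ : Nonempty (T ∩ pair x y) → x ∈ T ⊎ y ∈ T
∩pair-nonempty⁻ {T = T} {x} {y} = pair∩-nonempty⁻ ∘ subst Nonempty (∩-comm T (pair x y))

∉∉⇒Empty-∩pair : x ∉ T → y ∉ T → Empty (T ∩ pair x y)
∉∉⇒Empty-∩pair x∉T y∉T = [ x∉T , y∉T ]′ ∘ ∩pair-nonempty⁻

Empty-∩⇒∉ : Empty (p ∩ q) → x ∈ p → x ∉ q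
Empty-∩⇒∉ p∩q-empty x∈p x∈q = p∩q-empty (_ , x∈p∩q⁺ (x∈p , x∈q))

⊈⇒∃∉ : ¬ (p ⊆ q) → ∃[ x ] (x ∈ p × x ∉ q)
⊈⇒∃∉ {p = p} {q} p⊈q
  with Fin.¬∀⟶∃¬ _ (λ x → x ∈ p → x ∈ q) (λ x → x ∈? p →-dec x ∈? q) (λ p⊆q → p⊈q (p⊆q _))
... | x , x∉p⇒q with x ∈? p
... | yes x∈p = x , x∈p , λ x∈q → x∉p⇒q (λ _ → x∈q)
... | no x∉p = contradiction (λ x∈p → contradiction x∈p x∉p) x∉p⇒q

∣p∪q∣≤∣p∣+∣q∣ : (p q : Subset n) → ∣ p ∪ q ∣ ≤ ∣ p ∣ + ∣ q ∣
∣p∪q∣≤∣p∣+∣q∣ []            []            = z≤n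
∣p∪q∣≤∣p∣+∣q∣ (outside ∷ p) (outside ∷ q) = ∣p∪q∣≤∣p∣+∣q∣ p q
∣p∪q∣≤∣p∣+∣q∣ (outside ∷ p) (inside  ∷ q) =
  ℕ.≤-trans (s≤s (∣p∪q∣≤∣p∣+∣q∣ p q)) (ℕ.≤-reflexive (sym (ℕ.+-suc ∣ p ∣ ∣ q ∣)))
∣p∪q∣≤∣p∣+∣q∣ (inside  ∷ p) (outside ∷ q) = s≤s (∣p∪q∣≤∣p∣+∣q∣ p q)
∣p∪q∣≤∣p∣+∣q∣ (inside  ∷ p) (inside  ∷ q) =
  s≤s (ℕ.≤-trans (∣p∪q∣≤∣p∣+∣q∣ p q) (ℕ.+-monoʳ-≤ ∣ p ∣ (ℕ.n≤1+n ∣ q ∣)))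

∣p∣≡0⇒p≡⊥ : (p : Subset n) → ∣ p ∣ ≡ 0 → p ≡ ⊥
∣p∣≡0⇒p≡⊥ []            _  = refl
∣p∣≡0⇒p≡⊥ (outside ∷ p) eq = cong (outside ∷_) (∣p∣≡0⇒p≡⊥ p eq)

∣p∣≡1⇒p≡⁅x⁆ : (p : Subset n) → ∣ p ∣ ≡ 1 → ∃[ x ] p ≡ ⁅ x ⁆
∣p∣≡1⇒p≡⁅x⁆ (outside ∷ p) eq with ∣p∣≡1⇒p≡⁅x⁆ p eq
... | x , refl = suc x , refl
∣p∣≡1⇒p≡⁅x⁆ (inside ∷ p) eq with ∣p∣≡0⇒p≡⊥ p (ℕ.suc-injective eq)
... | refl = zero , refl

∣p∣≡2⇒p≡pair : (p : Subset n) → ∣ p ∣ ≡ 2 → ∃₂ λ x y → x ≢ y × p ≡ pair x y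
∣p∣≡2⇒p≡pair (outside ∷ p) eq with ∣p∣≡2⇒p≡pair p eq
... | x , y , x≢y , refl = suc x , suc y , x≢y ∘ Fin.suc-injective , refl
∣p∣≡2⇒p≡pair (inside ∷ p) eq with ∣p∣≡1⇒p≡⁅x⁆ p (ℕ.suc-injective eq)
... | y , refl = zero , suc y , (λ ()) , cong (inside ∷_) (sym (∪-identityˡ ⁅ y ⁆))

∣pair∣≡2⇒≢ : ∣ pair x y ∣ ≡ 2 → x ≢ y
∣pair∣≡2⇒≢ {x = x} ∣xx∣≡2 refl =
  contradiction (trans (sym (∣⁅x⁆∣≡1 x)) (trans (cong ∣_∣ (sym (∪-idem ⁅ x ⁆))) ∣xx∣≡2)) λ ()

two-set-through : ∣ T ∣ ≡ 2 → x ∈ T → ∃[ z ] (z ≢ x × T ≡ pair x z)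
two-set-through {T = T} ∣T∣≡2 x∈T with ∣p∣≡2⇒p≡pair T ∣T∣≡2
... | y , z , y≢z , refl with ∈pair⁻ x∈T
... | inj₁ refl = z , y≢z ∘ sym , refl
... | inj₂ refl = y , y≢z , pair-comm y z

two-set≡pair : ∣ T ∣ ≡ 2 → x ∈ T → y ∈ T → x ≢ y → T ≡ pair x y
two-set≡pair ∣T∣≡2 x∈T y∈T x≢y with two-set-through ∣T∣≡2 x∈T
... | z , _ , refl with ∈pair⁻ y∈T
... | inj₁ refl = contradiction refl x≢y
... | inj₂ refl = refl

member-of-nonempty : {X : Set} {xs : List X} → 1 ≤ length xs → ∃[ x ] x ∈ₗ xs
member-of-nonempty {xs = x ∷ _} _ = x , here refl

counterexample-or-all : {X : Set} {P : X → Set} → Decidable P → (xs : List X) →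
                        (∃[ x ] (x ∈ₗ xs × ¬ P x)) ⊎ (∀ x → x ∈ₗ xs → P x)
counterexample-or-all P? xs with all? P? xs
... | yes all = inj₂ (λ _ → lookup all)
... | no ¬all = inj₁ (find (¬All⇒Any¬ P? xs ¬all))

module _ {X : Set} (_≟_ : DecidableEquality X) where
  open DecMembership _≟_ using () renaming (_∈?_ to _∈ₗ?_)

  private
    without : X → List X → List X
    without y = filter (λ x → ¬? (x ≟ y))

    ∈-without : ∀ {x y ys} → x ∈ₗ ys → x ≢ y → x ∈ₗ without y ys
    ∈-without = ∈-filter⁺ (λ x → ¬? (x ≟ _))

    length-without< : ∀ {y ys} → y ∈ₗ ys → length (without y ys) < length ys
    length-without< y∈ys =
      List.filter-notAll (λ x → ¬? (x ≟ _)) _ (Any.map (λ { refl x≢x → x≢x refl }) y∈ys)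

  mutual
    unique⊆⇒length≤ : ∀ {xs ys} → Unique xs → (∀ x → x ∈ₗ xs → x ∈ₗ ys) → length xs ≤ length ys
    unique⊆⇒length≤ [] _ = z≤n
    unique⊆⇒length≤ (x∉xs ∷ xs!) xs⊆ys =
      unique⊆∌⇒length< xs! (λ x → xs⊆ys x ∘ there) (xs⊆ys _ (here refl))
                       (λ x∈xs → lookup x∉xs x∈xs refl)

    unique⊆∌⇒length< : ∀ {xs ys y} → Unique xs → (∀ x → x ∈ₗ xs → x ∈ₗ ys) →
                       y ∈ₗ ys → ¬ y ∈ₗ xs → length xs < length ys
    unique⊆∌⇒length< xs! xs⊆ys y∈ys y∉xs = ℕ.≤-<-trans
      (unique⊆⇒length≤ xs! (λ x x∈xs → ∈-without (xs⊆ys x x∈xs) λ { refl → y∉xs x∈xs }))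
      (length-without< y∈ys)

  unique⊆∧length≥⇒⊇ : ∀ {xs ys y} → Unique xs → (∀ x → x ∈ₗ xs → x ∈ₗ ys) →
                      length ys ≤ length xs → y ∈ₗ ys → y ∈ₗ xs
  unique⊆∧length≥⇒⊇ {xs} {y = y} xs! xs⊆ys ys≤xs y∈ys with y ∈ₗ? xs
  ... | yes y∈xs = y∈xs
  ... | no y∉xs = contradiction ys≤xs (ℕ.<⇒≱ (unique⊆∌⇒length< xs! xs⊆ys y∈ys y∉xs))

elements : Subset n → List (Fin n)
elements []            = []
elements (inside  ∷ p) = zero ∷ map suc (elements p)
elements (outside ∷ p) = map suc (elements p)

length-elements : (p : Subset n) → length (elements p) ≡ ∣ p ∣
length-elements []            = refl
length-elements (inside  ∷ p) =
  cong suc (trans (List.length-map suc (elements p)) (length-elements p))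
length-elements (outside ∷ p) = trans (List.length-map suc (elements p)) (length-elements p)

∈-elements : x ∈ p → x ∈ₗ elements p
∈-elements {p = inside  ∷ p} here        = here refl
∈-elements {p = inside  ∷ p} (there x∈p) = there (∈-map⁺ suc (∈-elements x∈p))
∈-elements {p = outside ∷ p} (there x∈p) = ∈-map⁺ suc (∈-elements x∈p)

pairs : List (Fin n) → Fam n
pairs []       = []
pairs (v ∷ vs) = map (pair v) vs ++ pairs vs

pair∈pairs : ∀ {vs} → x ∈ₗ vs → y ∈ₗ vs → x ≢ y → pair x y ∈ᶠ pairs vs
pair∈pairs (here refl) (here refl) x≢y = contradiction refl x≢y
pair∈pairs {x = x} (here refl) (there y∈vs) _ = ∈-++⁺ˡ (∈-map⁺ (pair x) y∈vs)
pair∈pairs {x = x} {y} (there x∈vs) (here refl) _ =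
  subst (_∈ᶠ _) (pair-comm y x) (∈-++⁺ˡ (∈-map⁺ (pair y) x∈vs))
pair∈pairs {vs = v ∷ vs} (there x∈vs) (there y∈vs) x≢y =
  ∈-++⁺ʳ (map (pair v) vs) (pair∈pairs x∈vs y∈vs x≢y)

two-set⊆⇒∈pairs : ∀ {vs} → (∀ {v} → v ∈ p → v ∈ₗ vs) → ∣ T ∣ ≡ 2 → T ⊆ p → T ∈ᶠ pairs vs
two-set⊆⇒∈pairs {T = T} p⊆vs ∣T∣≡2 T⊆p with ∣p∣≡2⇒p≡pair T ∣T∣≡2
... | x , y , x≢y , refl = pair∈pairs (p⊆vs (T⊆p (x∈pair x y))) (p⊆vs (T⊆p (y∈pair x y))) x≢y

∈pair∪pair⁻ : v ∈ pair x y ∪ pair u w → v ∈ₗ x ∷ y ∷ u ∷ w ∷ []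
∈pair∪pair⁻ {x = x} {y} {u} {w} v∈ with x∈p∪q⁻ (pair x y) (pair u w) v∈
... | inj₁ v∈xy = [ (λ v≡x → here v≡x) , (λ v≡y → there (here v≡y)) ]′ (∈pair⁻ v∈xy)
... | inj₂ v∈uw =
  [ (λ v≡u → there (there (here v≡u))) , (λ v≡w → there (there (there (here v≡w)))) ]′ (∈pair⁻ v∈uw)

allSubsets-complete : (p : Subset n) → p ∈ᶠ allSubsets n
allSubsets-complete []            = here refl
allSubsets-complete {suc n} (outside ∷ p) = ∈-++⁺ˡ (∈-map⁺ (outside ∷_) (allSubsets-complete p))
allSubsets-complete {suc n} (inside  ∷ p) =
  ∈-++⁺ʳ (map (outside ∷_) (allSubsets n)) (∈-map⁺ (inside ∷_) (allSubsets-complete p))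

allSubsets-unique : (n : ℕ) → Unique (allSubsets n)
allSubsets-unique zero = [] ∷ []
allSubsets-unique (suc n) =
  Unique.++⁺ (Unique.map⁺ ∷-injectiveʳ (allSubsets-unique n))
             (Unique.map⁺ ∷-injectiveʳ (allSubsets-unique n))
             outside-apart-from-inside
  where
  outside-apart-from-inside : ∀ {p} →
    ¬ (p ∈ᶠ map (outside ∷_) (allSubsets n) × p ∈ᶠ map (inside ∷_) (allSubsets n))
  outside-apart-from-inside (p∈out , p∈in) with ∈-map⁻ (outside ∷_) p∈out | ∈-map⁻ (inside ∷_) p∈in
  ... | _ , _ , refl | _ , _ , ()

∈N⁻ : T ∈ᶠ N F S → NCond F S T
∈N⁻ {n} = proj₂ ∘ ∈-filter⁻ (NCond? _ _) {xs = allSubsets n}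

∈P⁻ : e ∈ᶠ P F A → PCond F A e
∈P⁻ {n} = proj₂ ∘ ∈-filter⁻ (PCond? _ _) {xs = allSubsets n}

∈P⁺ : PCond F A e → e ∈ᶠ P F A
∈P⁺ {e = e} = ∈-filter⁺ (PCond? _ _) (allSubsets-complete e)

N-unique : (F : Fam n) (S : Subset n) → Unique (N F S)
N-unique {n} F S = Unique.filter⁺ (NCond? F S) (allSubsets-unique n)

N-uniform : Uniform 2 (N F S)
N-uniform T T∈N = proj₁ (∈N⁻ T∈N)

∈V⁺ : f ∈ᶠ G → x ∈ f → x ∈ V G
∈V⁺ (here refl) x∈f = x∈p∪q⁺ (inj₁ x∈f)
∈V⁺ (there f∈G) x∈f = x∈p∪q⁺ (inj₂ (∈V⁺ f∈G x∈f))

∈V⁻ : (G : Fam n) → x ∈ V G → ∃[ f ] (f ∈ᶠ G × x ∈ f)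
∈V⁻ []      x∈V = ⊥-elim (∉⊥ x∈V)
∈V⁻ (f ∷ G) x∈V with x∈p∪q⁻ f (V G) x∈V
... | inj₁ x∈f  = f , here refl , x∈f
... | inj₂ x∈VG with ∈V⁻ G x∈VG
... | g , g∈G , x∈g = g , there g∈G , x∈g

V-∷-⊆ : T ⊆ V G → V (T ∷ G) ⊆ V G
V-∷-⊆ {T = T} {G = G} T⊆VG x∈ = [ T⊆VG , id ]′ (x∈p∪q⁻ T (V G) x∈)

∣V∣≤k*length : (G : Fam n) → Uniform k G → ∣ V G ∣ ≤ k * length G
∣V∣≤k*length {n} {k} [] _ = subst (_≤ k * 0) (sym (∣⊥∣≡0 n)) z≤n
∣V∣≤k*length {k = k} (f ∷ G) G-uniform = begin
  ∣ f ∪ V G ∣              ≤⟨ ∣p∪q∣≤∣p∣+∣q∣ f (V G) ⟩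
  ∣ f ∣ + ∣ V G ∣          ≤⟨ ℕ.+-mono-≤ (ℕ.≤-reflexive (G-uniform f (here refl)))
                                         (∣V∣≤k*length G (λ g → G-uniform g ∘ there)) ⟩
  k + k * length G         ≡⟨ ℕ.*-suc k (length G) ⟨
  k * length (f ∷ G)       ∎
  where open ℕ.≤-Reasoning

cover-meets-link : Disjoint S A → e ⊆ A → Nonempty (e ∩ (T ∪ S)) → Nonempty (e ∩ T)
cover-meets-link {S = S} {A} {e} {T} S∩A≡⊥ e⊆A (x , x∈) with x∈p∩q⁻ e (T ∪ S) x∈
... | x∈e , x∈T∪S with x∈p∪q⁻ T S x∈T∪S
... | inj₁ x∈T = x , x∈p∩q⁺ (x∈e , x∈T)
... | inj₂ x∈S = ⊥-elim (∉⊥ (subst (x ∈_) S∩A≡⊥ (x∈p∩q⁺ (x∈S , e⊆A x∈e))))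

N-P-crossIntersecting : Disjoint S A → CrossIntersecting (N F S) (P F A)
N-P-crossIntersecting S∩A≡⊥ T e T∈N e∈P with ∈N⁻ T∈N | ∈P⁻ e∈P
... | _ , _ , T∪S∈F | _ , e⊆A , e-covers =
  subst Nonempty (∩-comm e T) (cover-meets-link S∩A≡⊥ e⊆A (lookup e-covers T∪S∈F))

SubCherry-⊆ : G ⊆ᶠ H → SubCherry H → SubCherry G
SubCherry-⊆ G⊆H (a , b , c , a≢b , a≢c , b≢c , H⊆cherry) =
  a , b , c , a≢b , a≢c , b≢c , λ e → H⊆cherry e ∘ G⊆H e

CherryForcingSubgraph : Fam n → Set
CherryForcingSubgraph {n} G = Σ (Fam n) λ H → H ⊆ᶠ G × ∣ V H ∣ ≤ 6 × SubCherry (P H ⊤)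

extend-by-link : F′ ⊆ᶠ F → Disjoint S A → S ⊆ V F′ → CherryForcingSubgraph (N F S) →
                 Σ (Fam n) λ F″ → F′ ⊆ᶠ F″ × F″ ⊆ᶠ F × ∣ V F″ ∣ ≤ ∣ V F′ ∣ + 6 × SubCherry (P F″ A)
extend-by-link {n} {F′} {F} {S} {A} F′⊆F S∩A≡⊥ S⊆VF′ (H , H⊆N , ∣VH∣≤6 , H-cherry) =
  F″ , (λ _ → ∈-++⁺ʳ (map (_∪ S) H)) , F″⊆F , ∣VF″∣≤ , SubCherry-⊆ P-F″⊆P-H H-cherry
  where
  F″ : Fam n
  F″ = map (_∪ S) H ++ F′

  F″⊆F : F″ ⊆ᶠ F
  F″⊆F f f∈F″ with ∈-++⁻ (map (_∪ S) H) f∈F″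
  ... | inj₂ f∈F′ = F′⊆F f f∈F′
  ... | inj₁ f∈H∪S with ∈-map⁻ (_∪ S) f∈H∪S
  ... | T , T∈H , refl = proj₂ (proj₂ (∈N⁻ (H⊆N T T∈H)))

  VF″⊆ : V F″ ⊆ V H ∪ V F′
  VF″⊆ x∈ with ∈V⁻ F″ x∈
  ... | f , f∈F″ , x∈f with ∈-++⁻ (map (_∪ S) H) f∈F″
  ... | inj₂ f∈F′ = x∈p∪q⁺ (inj₂ (∈V⁺ f∈F′ x∈f))
  ... | inj₁ f∈H∪S with ∈-map⁻ (_∪ S) f∈H∪S
  ... | T , T∈H , refl =
    x∈p∪q⁺ (Sum.map (∈V⁺ T∈H) S⊆VF′ (x∈p∪q⁻ T S x∈f))

  ∣VF″∣≤ : ∣ V F″ ∣ ≤ ∣ V F′ ∣ + 6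
  ∣VF″∣≤ = begin
    ∣ V F″ ∣              ≤⟨ p⊆q⇒∣p∣≤∣q∣ VF″⊆ ⟩
    ∣ V H ∪ V F′ ∣        ≤⟨ ∣p∪q∣≤∣p∣+∣q∣ (V H) (V F′) ⟩
    ∣ V H ∣ + ∣ V F′ ∣    ≤⟨ ℕ.+-monoˡ-≤ ∣ V F′ ∣ ∣VH∣≤6 ⟩
    6 + ∣ V F′ ∣          ≡⟨ ℕ.+-comm 6 ∣ V F′ ∣ ⟩
    ∣ V F′ ∣ + 6          ∎
    where open ℕ.≤-Reasoning

  P-F″⊆P-H : P F″ A ⊆ᶠ P H ⊤
  P-F″⊆P-H e e∈P with ∈P⁻ e∈P
  ... | ∣e∣≡2 , e⊆A , e-covers = ∈P⁺ (∣e∣≡2 , ⊆⊤ , tabulate λ T∈H →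
    cover-meets-link S∩A≡⊥ e⊆A (lookup e-covers (∈-++⁺ˡ (∈-map⁺ (_∪ S) T∈H))))

-- A 2-cover through the centre b ends in D; one avoiding b must be {a, a′}, which misses E.
fan-2-covers : pair b a ∈ᶠ H → pair b a′ ∈ᶠ H → D ∈ᶠ H → E ∈ᶠ H →
               a ≢ a′ → b ∉ D → a ∉ E → a′ ∉ E →
               ∣ e ∣ ≡ 2 → VertexCover H e → ∃[ z ] (z ∈ D × e ≡ pair b z)
fan-2-covers {b = b} {e = e} ba∈H ba′∈H D∈H E∈H a≢a′ b∉D a∉E a′∉E ∣e∣≡2 e-covers with b ∈? e
... | yes b∈e with two-set-through ∣e∣≡2 b∈e
... | z , _ , refl = z , [ ⊥-elim ∘ b∉D , id ]′ (pair∩-nonempty⁻ (lookup e-covers D∈H)) , refl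
fan-2-covers {b = b} {a} {H} {a′} {E = E} {e} ba∈H ba′∈H D∈H E∈H a≢a′ b∉D a∉E a′∉E ∣e∣≡2 e-covers
  | no b∉e =
  ⊥-elim ([ a∉E , a′∉E ]′ (pair∩-nonempty⁻ aa′-meets-E))
  where
  other-end∈e : ∀ {a} → pair b a ∈ᶠ H → a ∈ e
  other-end∈e ba∈H = [ ⊥-elim ∘ b∉e , id ]′ (∩pair-nonempty⁻ (lookup e-covers ba∈H))

  e≡aa′ : e ≡ pair a a′
  e≡aa′ = two-set≡pair ∣e∣≡2 (other-end∈e ba∈H) (other-end∈e ba′∈H) a≢a′

  aa′-meets-E : Nonempty (pair a a′ ∩ E)
  aa′-meets-E = subst (λ e → Nonempty (e ∩ E)) e≡aa′ (lookup e-covers E∈H)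

fan-subCherry : pair b a ∈ᶠ H → pair b a′ ∈ᶠ H → pair d d′ ∈ᶠ H → E ∈ᶠ H →
                a ≢ a′ → d ≢ d′ → b ∉ pair d d′ → a ∉ E → a′ ∉ E → SubCherry (P H A)
fan-subCherry {b = b} {H = H} {d = d} {d′} {A = A} ba∈H ba′∈H dd′∈H E∈H a≢a′ d≢d′ b∉dd′ a∉E a′∉E =
  b , d , d′ , proj₁ (∉pair⁻ b∉dd′) , proj₂ (∉pair⁻ b∉dd′) , d≢d′ , in-cherry
  where
  in-cherry : ∀ e → e ∈ᶠ P H A → e ≡ pair b d ⊎ e ≡ pair b d′
  in-cherry e e∈P with ∈P⁻ e∈P
  ... | ∣e∣≡2 , _ , e-covers
    with fan-2-covers ba∈H ba′∈H dd′∈H E∈H a≢a′ b∉dd′ a∉E a′∉E ∣e∣≡2 e-covers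
  ... | z , z∈dd′ , refl = Sum.map (cong (pair b)) (cong (pair b)) (∈pair⁻ z∈dd′)

disjoint-triple-no-2-cover : T₁ ∈ᶠ H → T₂ ∈ᶠ H → T₃ ∈ᶠ H →
                             Empty (T₁ ∩ T₂) → Empty (T₁ ∩ T₃) → Empty (T₂ ∩ T₃) →
                             ∣ e ∣ ≡ 2 → ¬ VertexCover H e
disjoint-triple-no-2-cover {e = e} T₁∈H T₂∈H T₃∈H ∅₁₂ ∅₁₃ ∅₂₃ ∣e∣≡2 e-covers
  with ∣p∣≡2⇒p≡pair e ∣e∣≡2
... | x , y , _ , refl
  with pair∩-nonempty⁻ (lookup e-covers T₁∈H) | pair∩-nonempty⁻ (lookup e-covers T₂∈H)
     | pair∩-nonempty⁻ (lookup e-covers T₃∈H)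
... | inj₁ x∈T₁ | inj₁ x∈T₂ | _         = Empty-∩⇒∉ ∅₁₂ x∈T₁ x∈T₂
... | inj₂ y∈T₁ | inj₂ y∈T₂ | _         = Empty-∩⇒∉ ∅₁₂ y∈T₁ y∈T₂
... | inj₁ x∈T₁ | inj₂ _    | inj₁ x∈T₃ = Empty-∩⇒∉ ∅₁₃ x∈T₁ x∈T₃
... | inj₁ _    | inj₂ y∈T₂ | inj₂ y∈T₃ = Empty-∩⇒∉ ∅₂₃ y∈T₂ y∈T₃
... | inj₂ _    | inj₁ x∈T₂ | inj₁ x∈T₃ = Empty-∩⇒∉ ∅₂₃ x∈T₂ x∈T₃
... | inj₂ y∈T₁ | inj₁ _    | inj₂ y∈T₃ = Empty-∩⇒∉ ∅₁₃ y∈T₁ y∈T₃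

Star : Fam n → Set
Star {n} G = ∃[ w ] (w ∈ V G × (∀ T → T ∈ᶠ G → w ∈ T))

module _ {G : Fam n} (G-uniform : Uniform 2 G) (G-unique : Unique G) (G-large : 6 ≤ length G) where

  private
    edge-through : T ∈ᶠ G → x ∈ T → ∃[ z ] (z ≢ x × T ≡ pair x z)
    edge-through T∈G = two-set-through (G-uniform _ T∈G)

    edge-≢ : pair x y ∈ᶠ G → x ≢ y
    edge-≢ xy∈G = ∣pair∣≡2⇒≢ (G-uniform _ xy∈G)

    K4-edge : (∀ T → T ∈ᶠ G → T ⊆ pair x y ∪ pair u v) → T ∈ᶠ pairs (x ∷ y ∷ u ∷ v ∷ []) → T ∈ᶠ G
    K4-edge G⊆Q = unique⊆∧length≥⇒⊇ _≟ₛ_ G-unique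
      (λ T T∈G → two-set⊆⇒∈pairs ∈pair∪pair⁻ (G-uniform T T∈G) (G⊆Q T T∈G)) G-large

    three-edges : All (_∈ᶠ G) (T₁ ∷ T₂ ∷ T₃ ∷ []) → ∣ V (T₁ ∷ T₂ ∷ T₃ ∷ []) ∣ ≤ 6
    three-edges H⊆G = ∣V∣≤k*length _ (λ T → G-uniform T ∘ lookup H⊆G)

    p3+k2 : pair b a ∈ᶠ G → pair b a′ ∈ᶠ G → pair d d′ ∈ᶠ G →
            a ≢ a′ → b ∉ pair d d′ → a ∉ pair d d′ → a′ ∉ pair d d′ → CherryForcingSubgraph G
    p3+k2 {b = b} {a} {a′} {d} {d′} ba∈G ba′∈G dd′∈G a≢a′ b∉dd′ a∉dd′ a′∉dd′ =
      _ , (λ _ → lookup H⊆G) , three-edges H⊆G ,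
      fan-subCherry (here refl) (there (here refl))
                    (there (there (here refl))) (there (there (here refl)))
                    a≢a′ (edge-≢ dd′∈G) b∉dd′ a∉dd′ a′∉dd′
      where
      H⊆G : All (_∈ᶠ G) (pair b a ∷ pair b a′ ∷ pair d d′ ∷ [])
      H⊆G = ba∈G ∷ ba′∈G ∷ dd′∈G ∷ []

    paw : pair b a ∈ᶠ G → pair b a′ ∈ᶠ G → pair a a′ ∈ᶠ G → pair b c ∈ᶠ G →
          b ∉ pair a a′ → a ∉ pair b c → a′ ∉ pair b c → CherryForcingSubgraph G
    paw {b = b} {a} {a′} {c} ba∈G ba′∈G aa′∈G bc∈G b∉aa′ a∉bc a′∉bc =
      _ , (λ _ → lookup H⊆G) , ∣VH∣≤6 ,
      fan-subCherry (there (here refl)) (there (there (here refl)))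
                    (here refl) (there (there (there (here refl))))
                    (edge-≢ aa′∈G) (edge-≢ aa′∈G) b∉aa′ a∉bc a′∉bc
      where
      H⊆G : All (_∈ᶠ G) (pair a a′ ∷ pair b a ∷ pair b a′ ∷ pair b c ∷ [])
      H⊆G = aa′∈G ∷ ba∈G ∷ ba′∈G ∷ bc∈G ∷ []

      ∣VH∣≤6 : ∣ V (pair a a′ ∷ pair b a ∷ pair b a′ ∷ pair b c ∷ []) ∣ ≤ 6
      ∣VH∣≤6 = ℕ.≤-trans (p⊆q⇒∣p∣≤∣q∣ (V-∷-⊆ {G = edges-at-b} aa′⊆V))
                         (three-edges (ba∈G ∷ ba′∈G ∷ bc∈G ∷ []))
        where
        edges-at-b : Fam _
        edges-at-b = pair b a ∷ pair b a′ ∷ pair b c ∷ []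

        aa′⊆V : pair a a′ ⊆ V edges-at-b
        aa′⊆V = pair⊆ (∈V⁺ {G = edges-at-b} (here refl) (y∈pair b a))
                      (∈V⁺ {G = edges-at-b} (there (here refl)) (y∈pair b a′))

    disjoint-triple : pair x y ∈ᶠ G → T₂ ∈ᶠ G → T₃ ∈ᶠ G → u ∈ T₂ →
                      Empty (pair x y ∩ T₂) → Empty (pair x y ∩ T₃) → Empty (T₂ ∩ T₃) →
                      CherryForcingSubgraph G
    disjoint-triple {x = x} {y} {T₂} {T₃} {u} xy∈G T₂∈G T₃∈G u∈T₂ ∅₁₂ ∅₁₃ ∅₂₃ =
      _ , (λ _ → lookup H⊆G) , three-edges H⊆G ,
      x , y , u , edge-≢ xy∈G , (λ { refl → Empty-∩⇒∉ ∅₁₂ (x∈pair x y) u∈T₂ }) ,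
      (λ { refl → Empty-∩⇒∉ ∅₁₂ (y∈pair x y) u∈T₂ }) , no-2-cover
      where
      H⊆G : All (_∈ᶠ G) (pair x y ∷ T₂ ∷ T₃ ∷ [])
      H⊆G = xy∈G ∷ T₂∈G ∷ T₃∈G ∷ []

      no-2-cover : ∀ e → e ∈ᶠ P (pair x y ∷ T₂ ∷ T₃ ∷ []) ⊤ → e ≡ pair x y ⊎ e ≡ pair x u
      no-2-cover e e∈P with ∈P⁻ e∈P
      ... | ∣e∣≡2 , _ , e-covers = ⊥-elim (disjoint-triple-no-2-cover
        (here refl) (there (here refl)) (there (there (here refl))) ∅₁₂ ∅₁₃ ∅₂₃ ∣e∣≡2 e-covers)

    case-meet-pendant : pair x y ∈ᶠ G → pair y b ∈ᶠ G → pair x a ∈ᶠ G → pair x c ∈ᶠ G →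
                   a ≢ x → a ≢ y → b ≢ x → b ≢ y → c ≢ x → c ≢ y → c ≢ a → c ≢ b →
                   CherryForcingSubgraph G
    case-meet-pendant {b = b} {a = a} xy∈G yb∈G xa∈G xc∈G a≢x a≢y b≢x b≢y c≢x c≢y c≢a c≢b
      with a Fin.≟ b
    ... | yes refl = paw xy∈G xa∈G yb∈G xc∈G
      (∉pair⁺ (edge-≢ xy∈G) (a≢x ∘ sym)) (∉pair⁺ (edge-≢ xy∈G ∘ sym) (c≢y ∘ sym))
      (∉pair⁺ a≢x (c≢a ∘ sym))
    ... | no a≢b = p3+k2 xa∈G xc∈G yb∈G
      (c≢a ∘ sym) (∉pair⁺ (edge-≢ xy∈G) (b≢x ∘ sym)) (∉pair⁺ a≢y a≢b) (∉pair⁺ c≢y c≢b)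

    case-meet-no-star : pair x y ∈ᶠ G → pair y b ∈ᶠ G → pair x a ∈ᶠ G →
                        a ≢ x → a ≢ y → b ≢ x → b ≢ y →
                        (∀ T → T ∈ᶠ G → Nonempty (pair x y ∩ T)) → CherryForcingSubgraph G
    case-meet-no-star {x = x} {y} {b} {a} xy∈G yb∈G xa∈G a≢x a≢y b≢x b≢y meets-xy
      with counterexample-or-all (_⊆? (pair x y ∪ pair a b)) G
    -- Six edges inside {x, y, a, b} include ab, which misses xy.
    ... | inj₂ G⊆Q =
      ⊥-elim ([ ∉pair⁺ a≢x a≢y , ∉pair⁺ b≢x b≢y ]′ (∩pair-nonempty⁻ (meets-xy _ ab∈G)))
      where
      ab∈G : pair a b ∈ᶠ G
      ab∈G = K4-edge G⊆Q (there (there (there (there (there (here refl))))))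
    ... | inj₁ (h , h∈G , h⊈Q) with ⊈⇒∃∉ h⊈Q
    ... | c , c∈h , c∉Q
      with edge-through h∈G c∈h | ∉pair⁻ (c∉Q ∘ x∈p∪q⁺ ∘ inj₁) | ∉pair⁻ (c∉Q ∘ x∈p∪q⁺ ∘ inj₂)
    ... | z , _ , refl | c≢x , c≢y | c≢a , c≢b with ∩pair-nonempty⁻ (meets-xy _ h∈G)
    ... | inj₁ c∈xy = ⊥-elim ([ c≢x , c≢y ]′ (∈pair⁻ c∈xy))
    ... | inj₂ z∈xy with ∈pair⁻ z∈xy
    ... | inj₁ refl = case-meet-pendant xy∈G yb∈G xa∈G (∈-pair-comm h∈G)
                                        a≢x a≢y b≢x b≢y c≢x c≢y c≢a c≢b
    ... | inj₂ refl = case-meet-pendant (∈-pair-comm xy∈G) xa∈G yb∈G (∈-pair-comm h∈G)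
                                        b≢y b≢x a≢y a≢x c≢y c≢x c≢b c≢a

    case-meet : pair x y ∈ᶠ G → (∀ T → T ∈ᶠ G → Nonempty (pair x y ∩ T)) →
                Star G ⊎ CherryForcingSubgraph G
    case-meet {x = x} {y} xy∈G meets-xy
      with counterexample-or-all (x ∈?_) G | counterexample-or-all (y ∈?_) G
    ... | inj₂ all∋x | _          = inj₁ (x , ∈V⁺ xy∈G (x∈pair x y) , all∋x)
    ... | inj₁ _     | inj₂ all∋y = inj₁ (y , ∈V⁺ xy∈G (y∈pair x y) , all∋y)
    ... | inj₁ (f , f∈G , x∉f) | inj₁ (g , g∈G , y∉g)
      with edge-through f∈G ([ ⊥-elim ∘ x∉f , id ]′ (pair∩-nonempty⁻ (meets-xy f f∈G)))
         | edge-through g∈G ([ id , ⊥-elim ∘ y∉g ]′ (pair∩-nonempty⁻ (meets-xy g g∈G)))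
    ... | b , b≢y , refl | a , a≢x , refl = inj₂ (case-meet-no-star xy∈G f∈G g∈G
      a≢x (λ { refl → y∉g (y∈pair x y) }) (λ { refl → x∉f (y∈pair y x) }) b≢y meets-xy)

    case-disjoint-pendant : T ∈ᶠ G → pair u v ∈ᶠ G → pair c z ∈ᶠ G → Empty (T ∩ pair u v) →
                          z ∈ T → c ∉ T → c ∉ pair u v → CherryForcingSubgraph G
    case-disjoint-pendant {c = c} T∈G uv∈G cz∈G T∩uv-empty z∈T c∉T c∉uv with edge-through T∈G z∈T
    ... | w , _ , refl = p3+k2 T∈G (∈-pair-comm cz∈G) uv∈G
      (λ { refl → c∉T (y∈pair _ c) }) (Empty-∩⇒∉ T∩uv-empty (x∈pair _ w))
      (Empty-∩⇒∉ T∩uv-empty (y∈pair _ w)) c∉uv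

    case-disjoint : pair x y ∈ᶠ G → pair u v ∈ᶠ G → Empty (pair x y ∩ pair u v) →
                    CherryForcingSubgraph G
    case-disjoint {x = x} {y} {u} {v} xy∈G uv∈G xy∩uv-empty
      with counterexample-or-all (_⊆? (pair x y ∪ pair u v)) G
    ... | inj₂ G⊆Q =
      paw xy∈G (K4-edge G⊆Q (there (here refl))) (K4-edge G⊆Q (there (there (there (here refl)))))
          (K4-edge G⊆Q (there (there (here refl))))
          (∉pair⁺ (edge-≢ xy∈G) x≢u) (∉pair⁺ (edge-≢ xy∈G ∘ sym) y≢v)
          (∉pair⁺ (x≢u ∘ sym) (edge-≢ uv∈G))
      where
      x≢u : x ≢ u
      x≢u = proj₁ (∉pair⁻ (Empty-∩⇒∉ xy∩uv-empty (x∈pair x y)))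
      y≢v : y ≢ v
      y≢v = proj₂ (∉pair⁻ (Empty-∩⇒∉ xy∩uv-empty (y∈pair x y)))
    ... | inj₁ (h , h∈G , h⊈Q) with ⊈⇒∃∉ h⊈Q
    ... | c , c∈h , c∉Q with edge-through h∈G c∈h
    ... | z , _ , refl with z ∈? (pair x y ∪ pair u v)
    ... | no z∉Q = disjoint-triple xy∈G uv∈G h∈G (x∈pair u v) xy∩uv-empty
      (∉∉⇒Empty-∩pair (c∉Q ∘ x∈p∪q⁺ ∘ inj₁) (z∉Q ∘ x∈p∪q⁺ ∘ inj₁))
      (∉∉⇒Empty-∩pair (c∉Q ∘ x∈p∪q⁺ ∘ inj₂) (z∉Q ∘ x∈p∪q⁺ ∘ inj₂))
    ... | yes z∈Q with x∈p∪q⁻ (pair x y) (pair u v) z∈Q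
    ... | inj₁ z∈xy = case-disjoint-pendant xy∈G uv∈G h∈G xy∩uv-empty z∈xy
      (c∉Q ∘ x∈p∪q⁺ ∘ inj₁) (c∉Q ∘ x∈p∪q⁺ ∘ inj₂)
    ... | inj₂ z∈uv = case-disjoint-pendant uv∈G xy∈G h∈G
      (subst Empty (∩-comm (pair x y) (pair u v)) xy∩uv-empty) z∈uv
      (c∉Q ∘ x∈p∪q⁺ ∘ inj₂) (c∉Q ∘ x∈p∪q⁺ ∘ inj₁)

  star-or-cherryForcing : Star G ⊎ CherryForcingSubgraph G
  star-or-cherryForcing with member-of-nonempty (ℕ.≤-trans (s≤s z≤n) G-large)
  ... | e₁ , e₁∈G with ∣p∣≡2⇒p≡pair e₁ (G-uniform e₁ e₁∈G)
  ... | x , y , _ , refl with counterexample-or-all (λ T → nonempty? (pair x y ∩ T)) G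
  ... | inj₂ meets-xy = case-meet e₁∈G meets-xy
  ... | inj₁ (e₂ , e₂∈G , xy∩e₂-empty) with ∣p∣≡2⇒p≡pair e₂ (G-uniform e₂ e₂∈G)
  ... | u , v , _ , refl = inj₂ (case-disjoint e₁∈G e₂∈G xy∩e₂-empty)

star⇒CompleteStar : Star (N F S) → ∣ ∁ S ∣ ≤ suc (length (N F S)) → CompleteStar (N F S) S
star⇒CompleteStar {n} {F} {S} (w , w∈V , all∋w) ∣∁S∣≤ = w , w∉S , λ T → spoke-of T , spoke∈N T
  where
  ∉S : T ∈ᶠ N F S → x ∈ T → x ∉ S
  ∉S T∈N x∈T x∈S = ∉⊥ (subst (_ ∈_) (proj₁ (proj₂ (∈N⁻ T∈N))) (x∈p∩q⁺ (x∈T , x∈S)))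

  w∉S : w ∉ S
  w∉S with ∈V⁻ (N F S) w∈V
  ... | T , T∈N , w∈T = ∉S T∈N w∈T

  Spoke : Subset n → Set
  Spoke T = ∃[ z ] ((z ∉ S) × (z ≢ w) × (T ≡ pair w z))

  spoke-of : ∀ T → T ∈ᶠ N F S → Spoke T
  spoke-of T T∈N with two-set-through (N-uniform T T∈N) (all∋w T T∈N)
  ... | z , z≢w , refl = z , ∉S T∈N (y∈pair w z) , z≢w , refl

  spokes : Fam n
  spokes = map (pair w) (elements (∁ S - w))

  ∈spokes : ∀ T → Spoke T → T ∈ᶠ spokes
  ∈spokes _ (z , z∉S , z≢w , refl) =
    ∈-map⁺ (pair w) (∈-elements (x∈p∧x≢y⇒x∈p-y (x∉p⇒x∈∁p z∉S) z≢w))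

  spokes≤N : length spokes ≤ length (N F S)
  spokes≤N = begin
    length spokes                ≡⟨ List.length-map (pair w) (elements (∁ S - w)) ⟩
    length (elements (∁ S - w))  ≡⟨ length-elements (∁ S - w) ⟩
    ∣ ∁ S - w ∣                  ≤⟨ ℕ.≤-pred (ℕ.≤-trans (x∈p⇒∣p-x∣<∣p∣ (x∉p⇒x∈∁p w∉S)) ∣∁S∣≤) ⟩
    length (N F S)               ∎
    where open ℕ.≤-Reasoning

  spoke∈N : ∀ T → Spoke T → T ∈ᶠ N F S
  spoke∈N T T-spoke = unique⊆∧length≥⇒⊇ _≟ₛ_ (N-unique F S)
    (λ T′ T′∈N → ∈spokes T′ (spoke-of T′ T′∈N)) spokes≤N (∈spokes T T-spoke)

m∸[n∸o]≤m∸n+o : ∀ m n o → m ∸ (n ∸ o) ≤ m ∸ n + o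
m∸[n∸o]≤m∸n+o m n o = ℕ.m≤n+o⇒m∸n≤o m (n ∸ o) (begin
  m                       ≤⟨ ℕ.m≤n+m∸n m n ⟩
  n + (m ∸ n)             ≤⟨ ℕ.+-monoˡ-≤ (m ∸ n) (ℕ.m≤n+m∸n n o) ⟩
  o + (n ∸ o) + (m ∸ n)   ≡⟨ cong (_+ (m ∸ n)) (ℕ.+-comm o (n ∸ o)) ⟩
  n ∸ o + o + (m ∸ n)     ≡⟨ ℕ.+-assoc (n ∸ o) o (m ∸ n) ⟩
  n ∸ o + (o + (m ∸ n))   ≡⟨ cong (n ∸ o +_) (ℕ.+-comm o (m ∸ n)) ⟩
  n ∸ o + (m ∸ n + o)     ∎)
  where open ℕ.≤-Reasoning

lemma3p1 : (k n : ℕ) → k ≥ 3 → n ≥ k + 2 →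
    (F : Fam n) → Uniform k F → Intersecting F →
    (F′ : Fam n) → F′ ⊆ᶠ F →
    (S A : Subset n) → Disjoint S A → S ⊆ V F′ → A ⊆ V F′ → ∣ S ∣ ≡ k ∸ 2 →
    CrossIntersecting (N F′ S) (P F′ A)
    × (length (N F S) ≥ n ∸ k + 1 → n ≥ k + 5 →
        CompleteStar (N F S) S
        ⊎ Σ (Fam n) (λ F″ → F′ ⊆ᶠ F″ × F″ ⊆ᶠ F
            × ∣ V F″ ∣ ≤ ∣ V F′ ∣ + 6 × SubCherry (P F″ A)))
lemma3p1 k n _ _ F _ _ F′ F′⊆F S A S∩A≡⊥ S⊆VF′ _ ∣S∣≡k∸2 =
  N-P-crossIntersecting S∩A≡⊥ , λ N-long n≥k+5 →
    Sum.map (λ star → star⇒CompleteStar star (∁S-bound N-long))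
            (extend-by-link F′⊆F S∩A≡⊥ S⊆VF′)
            (star-or-cherryForcing N-uniform (N-unique F S) (six-edges N-long n≥k+5))
  where
  ∁S-bound : length (N F S) ≥ n ∸ k + 1 → ∣ ∁ S ∣ ≤ suc (length (N F S))
  ∁S-bound N-long = begin
    ∣ ∁ S ∣            ≡⟨ ∣∁p∣≡n∸∣p∣ S ⟩
    n ∸ ∣ S ∣          ≡⟨ cong (n ∸_) ∣S∣≡k∸2 ⟩
    n ∸ (k ∸ 2)        ≤⟨ m∸[n∸o]≤m∸n+o n k 2 ⟩
    n ∸ k + 2          ≡⟨ ℕ.+-suc (n ∸ k) 1 ⟩
    suc (n ∸ k + 1)    ≤⟨ s≤s N-long ⟩
    suc (length (N F S)) ∎
    where open ℕ.≤-Reasoning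

  six-edges : length (N F S) ≥ n ∸ k + 1 → n ≥ k + 5 → 6 ≤ length (N F S)
  six-edges N-long n≥k+5 =
    ℕ.≤-trans (ℕ.+-monoˡ-≤ 1 (subst (_≤ n ∸ k) (ℕ.m+n∸m≡n k 5) (ℕ.∸-monoˡ-≤ k n≥k+5))) N-long
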